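{- Let $\Delta\ge 1$ be an integer. For any tree $T$ with maximum degree at most $\Delta$, there exist $s\in\mathbb{N}$ and vertices $x_1,\dots,x_s\in V(T)$ such that (a) for every $2\le i\le s$, $\mathrm{dist}_T(x_i,\langle x_1,\dots,x_{i-1}\rangle_T)=5$; (b) $|T|/(5\Delta^4)\le s\le (|T|+4)/5$; and (c) $\mathrm{dist}_T(x,\langle x_1,\dots,x_s\rangle_T)\le 4$ for all vertices $x\in V(T)$.
   Context: For vertices $x_1,\dots,x_m$ of a tree $T$, $\langle x_1,\dots,x_m\rangle_T$ denotes the minimal subtree of $T$ containing $x_1,\dots,x_m$ (the union of all paths in $T$ between pairs $x_i,x_j$). $\mathrm{dist}_T(x,y)$ is the length of the unique path in $T$ between $x$ and $y$, and for a vertex set (or subtree) $Y$, $\mathrm{dist}_T(x,Y)=\min_{y\in Y}\mathrm{dist}_T(x,y)$ (which is $0$ if $x\in Y$). $|T|$ is the number of vertices of $T$. -}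

module Defs where

open import Data.Nat using (ℕ; zero; suc; _≤_; _<_)
open import Data.Fin using (Fin; toℕ)
open import Data.Bool using (Bool; true; false)
open import Data.List using (List; []; _∷_; length; filterᵇ; allFin)
open import Data.List.Relation.Unary.Unique.Propositional using (Unique)
open import Data.Product using (Σ; ∃; _×_)
open import Relation.Binary.PropositionalEquality using (_≡_)
open import Relation.Nullary using (¬_)

record Graph (n : ℕ) : Set where
  field
    adj    : Fin n → Fin n → Bool
    sym    : ∀ x y → adj x y ≡ adj y x
    irrefl : ∀ x → adj x x ≡ false

module _ {n : ℕ} (G : Graph n) where
  open Graph G

  Adj : Fin n → Fin n → Set
  Adj x y = adj x y ≡ true

  degree : Fin n → ℕ
  degree v = length (filterᵇ (adj v) (allFin n))

  MaxDegreeAtMost : ℕ → Set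
  MaxDegreeAtMost Δ = ∀ v → degree v ≤ Δ

  -- Walk x y vs : vs is the vertex sequence of a walk from x to y
  -- (so it has length vs ∸ 1 edges).
  data Walk : Fin n → Fin n → List (Fin n) → Set where
    here : ∀ {x} → Walk x x (x ∷ [])
    step : ∀ {x y z vs} → Adj x y → Walk y z vs → Walk x z (x ∷ vs)

  PathVs : Fin n → Fin n → List (Fin n) → Set
  PathVs x y vs = Walk x y vs × Unique vs

  Connected : Set
  Connected = ∀ x y → ∃ λ vs → Walk x y vs

  HasCycle : Set
  HasCycle = ∃ λ x → ∃ λ y → ∃ λ vs → PathVs x y vs × 3 ≤ length vs × Adj y x

  IsTree : Set
  IsTree = 1 ≤ n × Connected × ¬ HasCycle

  DistLe : Fin n → Fin n → ℕ → Set
  DistLe x y d = ∃ λ vs → Walk x y vs × length vs ≤ suc d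

  -- v lies on a path between two vertices of the family x restricted to
  -- indices i with P i; i.e. v ∈ ⟨ x_i : P i ⟩
  InSpan : {s : ℕ} → (Fin s → Set) → (Fin s → Fin n) → Fin n → Set
  InSpan P x v = ∃ λ a → ∃ λ b → P a × P b × ∃ λ vs → PathVs (x a) (x b) vs × v ∈ᴸ vs
    where
      open import Data.List.Membership.Propositional renaming (_∈_ to _∈ᴸ_)

  DistSetLe : (Fin n → Set) → Fin n → ℕ → Set
  DistSetLe Y v d = ∃ λ y → Y y × DistLe v y d

  DistSetEq : (Fin n → Set) → Fin n → ℕ → Set
  DistSetEq Y v zero    = DistSetLe Y v zero
  DistSetEq Y v (suc d) = DistSetLe Y v (suc d) × ¬ DistSetLe Y v d

-- The sequence is built greedily with the vertex list P of its span.  While some vertex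
-- is at distance ≥ 5 from P, walking from it towards P meets a vertex x at distance
-- exactly 5; a geodesic x = u₅, …, u₁, u₀ ∈ P has uᵢ at distance exactly i, so adding x
-- adds exactly u₅, …, u₁ to the span.  Hence |P| = 5t − 4 after t steps, giving 5s ≤ n + 4
-- and termination.  Acyclicity enters only through convexity (a vertex set connected
-- through itself contains every path between its members), which identifies P with the
-- span.  For n ≤ 5Δ⁴s: if all vertices are within distance 4 of a list K whose members
-- have neighbours in K, a parity argument makes every vertex the end of a 4-edge walk from
-- a member of K, and there are at most |K|·Δ⁴ such walks.
module Submission where

open import Defs
open import Function using (_∘_)
open import Data.Nat using (ℕ; zero; suc; _≤_; _<_; _+_; _*_; _^_; z≤n; s≤s; _<?_)
open import Data.Nat.Properties
open import Data.Fin as Fin using (Fin; toℕ; fromℕ<)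
open import Data.Fin.Properties using (toℕ-fromℕ<; toℕ<n; any?)
open import Data.Product using (Σ; ∃; ∃₂; _×_; _,_; proj₂)
open import Data.Sum using (_⊎_; inj₁; inj₂)
open import Data.Unit using (⊤; tt)
open import Data.Empty using (⊥-elim)
open import Data.Bool.Properties using (T-≡)
open import Data.List using (List; []; _∷_; _++_; length; drop; concatMap; filterᵇ; allFin)
open import Data.List.Properties using (length-++; length-++-sucʳ; length-tabulate; ++-assoc)
open import Data.List.Relation.Unary.All as All using (All; []; _∷_)
import Data.List.Relation.Unary.All.Properties as All
open import Data.List.Relation.Unary.Any as Any using (here; there)
open import Data.List.Relation.Unary.AllPairs as AllPairs using ([]; _∷_)
open import Data.List.Relation.Unary.Unique.Propositional using (Unique)
import Data.List.Relation.Unary.Unique.Propositional.Properties as Unique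
open import Data.List.Relation.Binary.Subset.Propositional using (_⊆_)
open import Data.List.Relation.Binary.Subset.Propositional.Properties using (∷⁺ʳ)
open import Data.List.Relation.Binary.Disjoint.Propositional using (Disjoint)
open import Data.List.Membership.Propositional using (_∈_; _∉_; find; lose)
open import Data.List.Membership.Propositional.Properties
  using (∈-++⁺ˡ; ∈-++⁺ʳ; ∈-++⁻; ∈-∃++; ∈-concatMap⁺; ∈-concatMap⁻; ∈-filter⁺; ∈-filter⁻;
         ∈-allFin)
open import Function.Bundles using (Equivalence)
open import Relation.Binary.PropositionalEquality
  using (_≡_; _≢_; refl; sym; trans; cong; subst; subst₂; module ≡-Reasoning)
open import Relation.Nullary using (¬_; Dec; yes; no; ¬?)
open import Relation.Nullary.Decidable using (decidable-stable; T?)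

unique-⊆-length : ∀ {A : Set} {xs ys : List A} → Unique xs → xs ⊆ ys → length xs ≤ length ys
unique-⊆-length {xs = []} _ _ = z≤n
unique-⊆-length {xs = x ∷ xs} {ys} (x∉xs ∷ uniq) xs⊆ys with ∈-∃++ (xs⊆ys (here refl))
... | us , vs , refl = subst (suc (length xs) ≤_) (sym (length-++-sucʳ us x vs))
                         (s≤s (unique-⊆-length uniq xs⊆us++vs))
  where
  xs⊆us++vs : xs ⊆ us ++ vs
  xs⊆us++vs {e} e∈xs with ∈-++⁻ us (xs⊆ys (there e∈xs))
  ... | inj₁ e∈us = ∈-++⁺ˡ e∈us
  ... | inj₂ (here refl) = ⊥-elim (All.lookup x∉xs e∈xs refl)
  ... | inj₂ (there e∈vs) = ∈-++⁺ʳ us e∈vs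

unique-length-≤ : ∀ {n} {xs : List (Fin n)} → Unique xs → length xs ≤ n
unique-length-≤ {n} {xs} uniq =
  subst (length xs ≤_) (length-tabulate {n = n} (λ i → i)) (unique-⊆-length uniq (λ {e} _ → ∈-allFin e))

covering-length-≥ : ∀ {n} {xs : List (Fin n)} → (∀ v → v ∈ xs) → n ≤ length xs
covering-length-≥ {n} {xs} covers =
  subst (_≤ length xs) (length-tabulate {n = n} (λ i → i))
    (unique-⊆-length (Unique.allFin⁺ n) (λ {e} _ → covers e))

length-concatMap-≤ : ∀ {A B : Set} (f : A → List B) {b} → (∀ x → length (f x) ≤ b) →
                     ∀ xs → length (concatMap f xs) ≤ length xs * b
length-concatMap-≤ f bounded [] = z≤n
length-concatMap-≤ f {b} bounded (x ∷ xs) = begin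
  length (f x ++ concatMap f xs)          ≡⟨ length-++ (f x) ⟩
  length (f x) + length (concatMap f xs)  ≤⟨ +-mono-≤ (bounded x) (length-concatMap-≤ f bounded xs) ⟩
  b + length xs * b                       ∎
  where open ≤-Reasoning

drop-⊆ : ∀ {A : Set} m (xs : List A) → drop m xs ⊆ xs
drop-⊆ zero xs e∈ = e∈
drop-⊆ (suc m) (x ∷ xs) e∈ = there (drop-⊆ m xs e∈)

outside-inside-disjoint : ∀ {A : Set} {P : A → Set} {xs ys : List A} →
                          All (λ a → ¬ P a) xs → All P ys → Disjoint xs ys
outside-inside-disjoint outside inside (e∈xs , e∈ys) = All.lookup outside e∈xs (All.lookup inside e∈ys)

module Walks {n : ℕ} (G : Graph n) where
  open Graph G using (adj) renaming (sym to adj-sym)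
  open import Data.List.Membership.DecPropositional (Fin._≟_ {n}) using (_∈?_) public

  Vertex : Set
  Vertex = Fin n

  Adj-sym : ∀ {x y} → Adj G x y → Adj G y x
  Adj-sym {x} {y} x~y = trans (adj-sym y x) x~y

  walk-head : ∀ {x y vs} → Walk G x y vs → ∃ λ ws → vs ≡ x ∷ ws
  walk-head here = _ , refl
  walk-head (step _ _) = _ , refl

  walk-start∈ : ∀ {x y vs} → Walk G x y vs → x ∈ vs
  walk-start∈ w with _ , refl ← walk-head w = here refl

  walk-nonempty : ∀ {x y vs} → Walk G x y vs → 1 ≤ length vs
  walk-nonempty w with _ , refl ← walk-head w = s≤s z≤n

  walk-single : ∀ {x y v} → Walk G x y (v ∷ []) → x ≡ y
  walk-single here = refl
  walk-single (step _ w) with () ← walk-nonempty w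

  infixr 5 _⊕_
  _⊕_ : ∀ {x y z vs ws} → Walk G x y vs → Walk G y z ws → Walk G x z (vs ++ drop 1 ws)
  here ⊕ here = here
  here ⊕ step y~y' w = step y~y' w
  step x~x' v ⊕ w = step x~x' (v ⊕ w)

  reverse-walk : ∀ {x y vs} → Walk G x y vs → ∃ λ ws → Walk G y x ws × length ws ≡ length vs × ws ⊆ vs
  reverse-walk here = _ , here , refl , λ e∈ → e∈
  reverse-walk {x} (step {vs = vs} x~x' w) =
    let (ws , w⁻¹ , len , ws⊆vs) = reverse-walk w
    in ws ++ x ∷ [] , w⁻¹ ⊕ step (Adj-sym x~x') here ,
       trans (length-++ ws) (trans (+-comm (length ws) 1) (cong suc len)) , snoc-⊆ ws⊆vs
    where
    snoc-⊆ : ∀ {ws} → ws ⊆ vs → ws ++ x ∷ [] ⊆ x ∷ vs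
    snoc-⊆ {ws} ws⊆vs e∈ with ∈-++⁻ ws e∈
    ... | inj₁ e∈ws = there (ws⊆vs e∈ws)
    ... | inj₂ (here refl) = here refl

  walk-suffix : ∀ {a y x ws} → Walk G a y ws → x ∈ ws → ∃ λ m → Walk G x y (drop m ws)
  walk-suffix here (here refl) = 0 , here
  walk-suffix (step x~x' w) (here refl) = 0 , step x~x' w
  walk-suffix (step _ w) (there x∈) = let (m , w') = walk-suffix w x∈ in suc m , w'

  walk→path : ∀ {x y vs} → Walk G x y vs → ∃ λ ws → PathVs G x y ws × ws ⊆ vs
  walk→path here = _ , (here , [] ∷ []) , λ e∈ → e∈
  walk→path {x} (step x~x' w) with walk→path w
  ... | ws , (p , uniq) , ws⊆ with x ∈? ws
  ...   | yes x∈ws = let (m , p') = walk-suffix p x∈ws in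
          drop m ws , (p' , Unique.drop⁺ m uniq) , λ e∈ → there (ws⊆ (drop-⊆ m ws e∈))
  ...   | no x∉ws = x ∷ ws , (step x~x' p , All.¬Any⇒All¬ ws x∉ws ∷ uniq) , ∷⁺ʳ x ws⊆

  ConnectedVia : List Vertex → Vertex → Set
  ConnectedVia P h = ∀ {p} → p ∈ P → ∃ λ vs → Walk G p h vs × All (_∈ P) vs

  path-inside : ∀ {P h p q} → ConnectedVia P h → p ∈ P → q ∈ P →
                ∃ λ vs → PathVs G p q vs × All (_∈ P) vs
  path-inside via p∈P q∈P with via p∈P | via q∈P
  ... | _ , p⇝h , p⇝h∈P | _ , q⇝h , q⇝h∈P with reverse-walk q⇝h
  ... | _ , h⇝q , _ , h⇝q⊆ with walk→path (p⇝h ⊕ h⇝q)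
  ... | vs , path , vs⊆ =
        vs , path , All.anti-mono vs⊆ (All.++⁺ p⇝h∈P (All.drop⁺ 1 (All.anti-mono h⇝q⊆ q⇝h∈P)))

  first-step : ∀ {K y z vs} → Walk G y z vs → All (_∈ K) vs → y ≢ z → ∃ λ q → q ∈ K × Adj G y q
  first-step here _ y≢z = ⊥-elim (y≢z refl)
  first-step (step y~y' w) (_ ∷ w∈K) _ = _ , All.lookup w∈K (walk-start∈ w) , y~y'

  neighbours : Vertex → List Vertex
  neighbours u = filterᵇ (adj u) (allFin n)

  ∈-neighbours⁺ : ∀ {u y} → Adj G u y → y ∈ neighbours u
  ∈-neighbours⁺ {u} {y} u~y = ∈-filter⁺ (T? ∘ adj u) (∈-allFin y) (Equivalence.from T-≡ u~y)

  ∈-neighbours⁻ : ∀ {u y} → y ∈ neighbours u → Adj G u y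
  ∈-neighbours⁻ {u} y∈ = Equivalence.to T-≡ (proj₂ (∈-filter⁻ (T? ∘ adj u) {xs = allFin n} y∈))

module Distances {n : ℕ} (G : Graph n) where
  open Walks G

  module _ {Y : Vertex → Set} where
    near-self : ∀ {u k} → Y u → DistSetLe G Y u k
    near-self u∈Y = _ , u∈Y , _ , here , s≤s z≤n

    near-step : ∀ {u u' k} → Adj G u u' → DistSetLe G Y u' k → DistSetLe G Y u (suc k)
    near-step u~u' (y , y∈Y , vs , w , len) = y , y∈Y , _ ∷ vs , step u~u' w , s≤s len

    near-mono : ∀ {u k m} → k ≤ m → DistSetLe G Y u k → DistSetLe G Y u m
    near-mono k≤m (y , y∈Y , vs , w , len) = y , y∈Y , vs , w , ≤-trans len (s≤s k≤m)

    near-zero : ∀ {u} → DistSetLe G Y u 0 → Y u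
    near-zero (_ , y∈Y , _ , here , _) = y∈Y
    near-zero (_ , _ , _ , step _ w , s≤s len) = ⊥-elim (<⇒≱ (walk-nonempty w) len)

    near-towards : ∀ {u k} → DistSetLe G Y u (suc k) → ¬ Y u → ∃ λ u' → Adj G u u' × DistSetLe G Y u' k
    near-towards (_ , y∈Y , _ , here , _) u∉Y = ⊥-elim (u∉Y y∈Y)
    near-towards (y , y∈Y , _ , step u~u' w , s≤s len) _ = _ , u~u' , y , y∈Y , _ , w , len

    exact-step : ∀ {u} k → DistSetEq G Y u (suc k) → ∃ λ u' → Adj G u u' × DistSetEq G Y u' k
    exact-step zero (near , far) = near-towards near (far ∘ near-self)
    exact-step (suc k) (near , far) =
      let (u' , u~u' , near') = near-towards near (far ∘ near-self) in u' , u~u' , near' , far ∘ near-step u~u'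

  near-map : ∀ {Y Y' : Vertex → Set} {u k} → (∀ {y} → Y y → Y' y) →
             DistSetLe G Y u k → DistSetLe G Y' u k
  near-map Y⊆Y' (y , y∈Y , route) = y , Y⊆Y' y∈Y , route

  exact-map : ∀ {Y Y' : Vertex → Set} {u} k → (∀ {y} → Y y → Y' y) → (∀ {y} → Y' y → Y y) →
              DistSetEq G Y u k → DistSetEq G Y' u k
  exact-map zero Y⊆Y' _ near = near-map Y⊆Y' near
  exact-map (suc k) Y⊆Y' Y'⊆Y (near , far) = near-map Y⊆Y' near , far ∘ near-map Y'⊆Y

  ball : ℕ → Vertex → List Vertex
  ball zero u = u ∷ []
  ball (suc k) u = u ∷ concatMap (ball k) (neighbours u)

  dist→ball : ∀ {u y} k → DistLe G u y k → y ∈ ball k u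
  dist→ball zero (_ , here , _) = here refl
  dist→ball zero (_ , step _ w , s≤s len) = ⊥-elim (<⇒≱ (walk-nonempty w) len)
  dist→ball (suc k) (_ , here , _) = here refl
  dist→ball (suc k) (_ , step u~u' w , s≤s len) =
    there (∈-concatMap⁺ (ball k) (lose (∈-neighbours⁺ u~u') (dist→ball k (_ , w , len))))

  ball→dist : ∀ {u y} k → y ∈ ball k u → DistLe G u y k
  ball→dist zero (here refl) = _ , here , ≤-refl
  ball→dist (suc k) (here refl) = _ , here , s≤s z≤n
  ball→dist {u} (suc k) (there y∈) with find (∈-concatMap⁻ (ball k) {xs = neighbours u} y∈)
  ... | _ , u'∈ , y∈ball with ball→dist k y∈ball
  ... | vs , w , len = u ∷ vs , step (∈-neighbours⁻ u'∈) w , s≤s len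

  near? : ∀ P u k → Dec (DistSetLe G (_∈ P) u k)
  near? P u k with Any.any? (_∈? P) (ball k u)
  ... | yes found = let (y , y∈ball , y∈P) = find found in yes (y , y∈P , ball→dist k y∈ball)
  ... | no none = no λ { (y , y∈P , route) → none (lose (dist→ball k route) y∈P) }

  exact-distance : ∀ {P} D k {u} → DistSetLe G (_∈ P) u D → ¬ DistSetLe G (_∈ P) u k →
                   ∃ λ x → DistSetEq G (_∈ P) x (suc k)
  exact-distance zero k near far = ⊥-elim (far (near-mono z≤n near))
  exact-distance {P} (suc D) k {u} near far with near? P u (suc k)
  ... | yes near' = u , near' , far
  ... | no far' with near-towards near (far ∘ near-self)
  ... | u' , u~u' , near'' = exact-distance D k near'' (far' ∘ near-step u~u')

  -- Descent Y k u w vs: the walk u = u_k, u_{k-1}, …, u_1, w = u_0 with vertex list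
  -- vs ++ [w], where each uᵢ is at exact distance i from Y and w ∈ Y.
  data Descent (Y : Vertex → Set) : ℕ → Vertex → Vertex → List Vertex → Set where
    arrive  : ∀ {w} → Y w → Descent Y zero w w []
    descend : ∀ {k u u' w vs} → Adj G u u' → DistSetEq G Y u (suc k) →
              Descent Y k u' w vs → Descent Y (suc k) u w (u ∷ vs)

  module _ {Y : Vertex → Set} where
    descent : ∀ k {u} → DistSetEq G Y u k → ∃₂ λ w vs → Descent Y k u w vs
    descent zero near = _ , _ , arrive (near-zero near)
    descent (suc k) exact =
      let (u' , u~u' , exact') = exact-step k exact
          (w , vs , d) = descent k exact'
      in w , _ , descend u~u' exact d

    descent-length : ∀ {k u w vs} → Descent Y k u w vs → length vs ≡ k
    descent-length (arrive _) = refl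
    descent-length (descend _ _ d) = cong suc (descent-length d)

    descent-target : ∀ {k u w vs} → Descent Y k u w vs → Y w
    descent-target (arrive w∈Y) = w∈Y
    descent-target (descend _ _ d) = descent-target d

    descent-start∈ : ∀ {k u w vs} → Descent Y (suc k) u w vs → u ∈ vs
    descent-start∈ (descend _ _ _) = here refl

    descent-exact : ∀ {k u w vs} → Descent Y (suc k) u w vs → DistSetEq G Y u (suc k)
    descent-exact (descend _ exact _) = exact

    descent-outside : ∀ {k u w vs} → Descent Y k u w vs → All (λ v → ¬ Y v) vs
    descent-outside (arrive _) = []
    descent-outside (descend _ (_ , far) d) = far ∘ near-self ∷ descent-outside d

    descent-near : ∀ {k u w vs} → Descent Y k u w vs → All (λ v → DistSetLe G Y v k) vs
    descent-near (arrive _) = []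
    descent-near (descend _ (near , _) d) = near ∷ All.map (near-mono (n≤1+n _)) (descent-near d)

    -- ... and are pairwise distinct, their distances to Y being distinct.
    descent-unique : ∀ {k u w vs} → Descent Y k u w vs → Unique vs
    descent-unique (arrive _) = []
    descent-unique (descend {k} _ (_ , far) d) =
      All.map (λ near u≡v → far (subst (λ z → DistSetLe G Y z k) (sym u≡v) near)) (descent-near d)
      ∷ descent-unique d

    descent-walk : ∀ {k u w vs y ws} → Descent Y k u w vs → Walk G w y ws → Walk G u y (vs ++ ws)
    descent-walk (arrive _) w = w
    descent-walk (descend u~u' _ d) w = step u~u' (descent-walk d w)

module Counting {n : ℕ} (G : Graph n) where
  open Walks G

  ends : ℕ → Vertex → List Vertex
  ends zero u = u ∷ []
  ends (suc k) u = concatMap (ends k) (neighbours u)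

  ends-length : ∀ {Δ} → MaxDegreeAtMost G Δ → ∀ k u → length (ends k u) ≤ Δ ^ k
  ends-length maxdeg zero u = ≤-refl
  ends-length {Δ} maxdeg (suc k) u = begin
    length (concatMap (ends k) (neighbours u))
      ≤⟨ length-concatMap-≤ (ends k) (ends-length maxdeg k) (neighbours u) ⟩
    degree G u * Δ ^ k
      ≤⟨ *-monoˡ-≤ (Δ ^ k) (maxdeg u) ⟩
    Δ * Δ ^ k
      ∎
    where open ≤-Reasoning

  ends-step : ∀ {k u u' v} → Adj G u u' → v ∈ ends k u' → v ∈ ends (suc k) u
  ends-step {k} {u} u~u' v∈ =
    ∈-concatMap⁺ (ends k) {xs = neighbours u} (lose (∈-neighbours⁺ u~u') v∈)

  walk→ends : ∀ {u v vs} → Walk G u v (u ∷ vs) → v ∈ ends (length vs) u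
  walk→ends here = here refl
  walk→ends (step u~u' here) = ends-step {0} u~u' (here refl)
  walk→ends (step u~u' (step {vs = vs} u'~u'' w)) =
    ends-step {length vs} u~u' (walk→ends (step u'~u'' w))

  ends-parity : ∀ {y q v j} k → Adj G y q → v ∈ ends j y → j ≤ k → v ∈ ends k y ⊎ v ∈ ends k q
  ends-parity zero _ v∈ z≤n = inj₁ v∈
  ends-parity (suc k) y~q v∈ j≤1+k with m≤n⇒m<n∨m≡n j≤1+k
  ... | inj₂ refl = inj₁ v∈
  ... | inj₁ j<1+k with ends-parity k y~q v∈ (≤-pred j<1+k)
  ...   | inj₁ v∈y = inj₂ (ends-step {k} (Adj-sym y~q) v∈y)
  ...   | inj₂ v∈q = inj₁ (ends-step {k} y~q v∈q)

  near→ends : ∀ {y q v k} → Adj G y q → DistLe G v y k → v ∈ ends k y ⊎ v ∈ ends k q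
  near→ends {k = k} y~q (vs , v⇝y , len) with reverse-walk v⇝y
  ... | _ , y⇝v , len⁻¹ , _ with walk-head y⇝v
  ... | _ , refl = ends-parity k y~q (walk→ends y⇝v) (≤-pred (subst (_≤ suc k) (sym len⁻¹) len))

  cover-count : ∀ {Δ} → MaxDegreeAtMost G Δ → ∀ k (K : List Vertex) →
                (∀ v → DistSetLe G (_∈ K) v k) →
                (∀ {y} → y ∈ K → ∃ λ q → q ∈ K × Adj G y q) →
                n ≤ length K * Δ ^ k
  cover-count maxdeg k K near neighbour =
    ≤-trans (covering-length-≥ covered) (length-concatMap-≤ (ends k) (ends-length maxdeg k) K)
    where
    covered : ∀ v → v ∈ concatMap (ends k) K
    covered v with near v
    ... | y , y∈K , route with neighbour y∈K
    ... | q , q∈K , y~q with near→ends y~q route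
    ... | inj₁ v∈ = ∈-concatMap⁺ (ends k) (lose y∈K v∈)
    ... | inj₂ v∈ = ∈-concatMap⁺ (ends k) (lose q∈K v∈)

  isolated-or-neighbour : Connected G → ∀ h → n ≤ 1 ⊎ ∃ λ q → Adj G h q
  isolated-or-neighbour conn h with any? (λ v → ¬? (v Fin.≟ h))
  ... | no only-h = inj₁ (covering-length-≥ {xs = h ∷ []} (λ v → here (is-h v)))
    where
    is-h : ∀ v → v ≡ h
    is-h v = decidable-stable (v Fin.≟ h) (λ v≢h → only-h (v , v≢h))
  ... | yes (v , v≢h) with conn h v
  ... | _ , here = ⊥-elim (v≢h refl)
  ... | _ , step h~q _ = inj₂ (_ , h~q)

-- Convexity in forests.
module Forests {n : ℕ} (G : Graph n) (acyclic : ¬ HasCycle G) where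
  open Walks G

  first-entry : ∀ {P u b vs} → PathVs G u b vs → b ∈ P → u ∉ P →
                ∃₂ λ os z → PathVs G u z (u ∷ os ++ z ∷ []) × (u ∷ os ++ z ∷ []) ⊆ vs ×
                            All (_∉ P) (u ∷ os) × z ∈ P
  first-entry (here , _) b∈P u∉P = ⊥-elim (u∉P b∈P)
  first-entry {P} {u} (step {y = u'} u~u' w , u∉w ∷ uniq) b∈P u∉P with u' ∈? P
  ... | yes u'∈P =
        [] , u' , (step u~u' here , (u≢u' ∷ []) ∷ [] ∷ []) , segment⊆ , u∉P ∷ [] , u'∈P
    where
    u≢u' : u ≢ u'
    u≢u' refl = u∉P u'∈P
    segment⊆ : u ∷ u' ∷ [] ⊆ u ∷ _
    segment⊆ (here refl) = here refl
    segment⊆ (there (here refl)) = there (walk-start∈ w)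
  ... | no u'∉P with first-entry (w , uniq) b∈P u'∉P
  ... | os , z , (segment , segment-uniq) , segment⊆ , outside , z∈P =
        u' ∷ os , z , (step u~u' segment , All.anti-mono segment⊆ u∉w ∷ segment-uniq) ,
        ∷⁺ʳ u segment⊆ , u∉P ∷ outside , z∈P

  -- Leaving P along an edge a–u, re-entering it at z, and returning from z to a inside P
  -- closes a cycle.
  detour-cycle : ∀ {P a u z os c cs} → Adj G a u →
                 PathVs G u z (u ∷ os ++ z ∷ []) → All (_∉ P) (u ∷ os) →
                 PathVs G z a (z ∷ c ∷ cs) → All (_∈ P) (c ∷ cs) → HasCycle G
  detour-cycle {a = a} {u} {z} {os} {c} {cs} a~u (segment , segment-uniq) outside (back , back-uniq) back∈P =
    u , a , u ∷ os ++ z ∷ c ∷ cs , (cycle , cycle-uniq) , three , a~u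
    where
    reassociate : (u ∷ os ++ z ∷ []) ++ c ∷ cs ≡ u ∷ os ++ z ∷ c ∷ cs
    reassociate = cong (u ∷_) (++-assoc os (z ∷ []) (c ∷ cs))
    cycle : Walk G u a (u ∷ os ++ z ∷ c ∷ cs)
    cycle = subst (Walk G u a) reassociate (segment ⊕ back)
    disjoint : Disjoint (u ∷ os ++ z ∷ []) (c ∷ cs)
    disjoint {e} (e∈segment , e∈back) with ∈-++⁻ (u ∷ os) e∈segment
    ... | inj₁ e∈u∷os = outside-inside-disjoint outside back∈P (e∈u∷os , e∈back)
    ... | inj₂ (here refl) = All.lookup (AllPairs.head back-uniq) e∈back refl
    cycle-uniq : Unique (u ∷ os ++ z ∷ c ∷ cs)
    cycle-uniq = subst Unique reassociate (Unique.++⁺ segment-uniq (AllPairs.tail back-uniq) disjoint)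
    three : 3 ≤ length (u ∷ os ++ z ∷ c ∷ cs)
    three = s≤s (subst (2 ≤_) (sym (trans (length-++-sucʳ os z (c ∷ cs))
                                          (cong suc (length-++-sucʳ os c cs))))
                       (s≤s (s≤s z≤n)))

  convex : ∀ {P h a b vs} → ConnectedVia P h → PathVs G a b vs → a ∈ P → b ∈ P → All (_∈ P) vs
  convex via (here , _) a∈P _ = a∈P ∷ []
  convex {P} via (step {y = u} a~u w , a∉w ∷ uniq) a∈P b∈P with u ∈? P
  ... | yes u∈P = a∈P ∷ convex via (w , uniq) u∈P b∈P
  ... | no u∉P with first-entry (w , uniq) b∈P u∉P
  ... | os , z , segment , segment⊆ , outside , z∈P with path-inside via z∈P a∈P
  ... | _ , (back , back-uniq) , back∈P with walk-head back
  -- the way back from z to a is not trivial, since a does not recur on the path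
  ... | [] , refl = ⊥-elim (All.lookup a∉w (segment⊆ z∈segment) (sym (walk-single back)))
    where
    z∈segment : z ∈ u ∷ os ++ z ∷ []
    z∈segment = there (∈-++⁺ʳ os (here refl))
  ... | c ∷ cs , refl =
        ⊥-elim (acyclic (detour-cycle a~u segment outside (back , back-uniq) (All.tail back∈P)))

module Greedy {n : ℕ} (G : Graph n) (connected : Connected G) (acyclic : ¬ HasCycle G) where
  open Walks G
  open Distances G
  open Counting G
  open Forests G acyclic

  Span : (ℕ → Vertex) → ℕ → Vertex → Set
  Span c i v = ∃₂ λ a b → a < i × b < i × ∃ λ vs → PathVs G (c a) (c b) vs × v ∈ vs

  span-cong : ∀ {c c' i v} → (∀ {k} → k < i → c k ≡ c' k) → Span c i v → Span c' i v
  span-cong c≡c' (a , b , a<i , b<i , vs , (w , uniq) , v∈) =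
    a , b , a<i , b<i , vs , (subst₂ (λ p q → Walk G p q vs) (c≡c' a<i) (c≡c' b<i) w , uniq) , v∈

  span-mono : ∀ {c i j v} → i ≤ j → Span c i v → Span c j v
  span-mono i≤j (a , b , a<i , b<i , path) = a , b , ≤-trans a<i i≤j , ≤-trans b<i i≤j , path

  extend : (ℕ → Vertex) → ℕ → Vertex → ℕ → Vertex
  extend c t x k with k <? t
  ... | yes _ = c k
  ... | no _ = x

  extend-< : ∀ c t x {k} → k < t → extend c t x k ≡ c k
  extend-< c t x {k} k<t with k <? t
  ... | yes _ = refl
  ... | no k≮t = ⊥-elim (k≮t k<t)

  extend-≡ : ∀ c t x → extend c t x t ≡ x
  extend-≡ c t x with t <? t
  ... | yes t<t = ⊥-elim (<-irrefl refl t<t)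
  ... | no _ = refl

  record Skeleton (t : ℕ) (c : ℕ → Vertex) (P : List Vertex) : Set where
    field
      t≥1       : 1 ≤ t
      unique    : Unique P
      size      : length P + 4 ≡ 5 * t
      via-root  : ConnectedVia P (c 0)
      P⊆span    : ∀ {p} → p ∈ P → Span c t p
      centres∈P : ∀ k → k < t → c k ∈ P
      separated : ∀ i → 1 ≤ i → i < t → DistSetEq G (Span c i) (c i) 5

    -- By convexity, P is exactly the span.
    span⊆P : ∀ {v} → Span c t v → v ∈ P
    span⊆P (a , b , a<t , b<t , vs , path , v∈) =
      All.lookup (convex via-root path (centres∈P a a<t) (centres∈P b b<t)) v∈

    t≤|P| : t ≤ length P
    t≤|P| = +-cancelʳ-≤ 4 t (length P) (subst (t + 4 ≤_) (sym size) (+-monoʳ-≤ t (*-monoʳ-≤ 4 t≥1)))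

    |P|<5t : length P < 5 * t
    |P|<5t = subst (suc (length P) ≤_) (trans (+-comm 4 (length P)) size) (s≤s (m≤n+m (length P) 3))

  initial : ∀ r → Skeleton 1 (λ _ → r) (r ∷ [])
  initial r = record
    { t≥1       = ≤-refl
    ; unique    = [] ∷ []
    ; size      = refl
    ; via-root  = λ { (here refl) → _ , here , here refl ∷ [] }
    ; P⊆span    = λ { (here refl) → 0 , 0 , s≤s z≤n , s≤s z≤n , _ , (here , [] ∷ []) , here refl }
    ; centres∈P = λ _ _ → here refl
    ; separated = λ _ i≥1 i<1 → ⊥-elim (<⇒≱ i<1 i≥1)
    }

  -- Extending a skeleton by a vertex x at distance exactly 5 from P, using a descent
  -- x = u₅, …, u₁ (the list vs), w ∈ P: the new span is P ++ vs.
  module Extension {t c P x w vs} (sk : Skeleton t c P) (d : Descent (_∈ P) 5 x w vs) where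
    open Skeleton sk

    c' : ℕ → Vertex
    c' = extend c t x

    P' : List Vertex
    P' = P ++ vs

    old : ∀ {k} → k < t → c k ≡ c' k
    old k<t = sym (extend-< c t x k<t)

    root : c' 0 ≡ c 0
    root = extend-< c t x t≥1

    route : ∃ λ qs → PathVs G x (c 0) (vs ++ qs) × All (_∈ P) qs
    route with path-inside via-root (descent-target d) (centres∈P 0 t≥1)
    ... | qs , (w⇝root , uniq) , qs∈P =
          qs , (descent-walk d w⇝root ,
                Unique.++⁺ (descent-unique d) uniq (outside-inside-disjoint (descent-outside d) qs∈P)) ,
          qs∈P

    inside-P' : ∀ {qs} → All (_∈ P) qs → All (_∈ P') (vs ++ qs)
    inside-P' qs∈P = All.++⁺ (All.tabulate (∈-++⁺ʳ P)) (All.map ∈-++⁺ˡ qs∈P)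

    unique' : Unique P'
    unique' = Unique.++⁺ unique (descent-unique d)
                (λ (p∈P , p∈vs) → All.lookup (descent-outside d) p∈vs p∈P)

    size' : length P' + 4 ≡ 5 * suc t
    size' = begin
      length (P ++ vs) + 4  ≡⟨ cong (_+ 4) (trans (length-++ P) (cong (length P +_) (descent-length d))) ⟩
      length P + 5 + 4      ≡⟨ cong (_+ 4) (+-comm (length P) 5) ⟩
      5 + (length P + 4)    ≡⟨ cong (5 +_) size ⟩
      5 + 5 * t             ≡⟨ sym (*-suc 5 t) ⟩
      5 * suc t             ∎
      where open ≡-Reasoning

    -- a new vertex reaches the root along the rest of the route
    via-root' : ConnectedVia P' (c 0)
    via-root' p∈P' with ∈-++⁻ P p∈P'
    ... | inj₁ p∈P = let (ws , p⇝root , inside) = via-root p∈P in ws , p⇝root , All.map ∈-++⁺ˡ inside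
    ... | inj₂ p∈vs with route
    ... | qs , (x⇝root , _) , qs∈P =
          let (m , p⇝root) = walk-suffix x⇝root (∈-++⁺ˡ p∈vs)
          in _ , p⇝root , All.drop⁺ m (inside-P' qs∈P)

    -- a new vertex lies on the route from x = c' t to the root
    P'⊆span : ∀ {p} → p ∈ P' → Span c' (suc t) p
    P'⊆span p∈P' with ∈-++⁻ P p∈P'
    ... | inj₁ p∈P = span-mono (n≤1+n t) (span-cong old (P⊆span p∈P))
    ... | inj₂ p∈vs with route
    ... | qs , (x⇝root , uniq) , _ =
          t , 0 , ≤-refl , s≤s z≤n , vs ++ qs ,
          (subst₂ (λ p q → Walk G p q (vs ++ qs)) (sym (extend-≡ c t x)) (sym root) x⇝root , uniq) ,
          ∈-++⁺ˡ p∈vs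

    centres∈P' : ∀ k → k < suc t → c' k ∈ P'
    centres∈P' k k<1+t with m<1+n⇒m<n∨m≡n k<1+t
    ... | inj₁ k<t = subst (_∈ P') (old k<t) (∈-++⁺ˡ (centres∈P k k<t))
    ... | inj₂ refl = subst (_∈ P') (sym (extend-≡ c t x)) (∈-++⁺ʳ P (descent-start∈ d))

    -- for i = t, condition (a) is the exact distance 5 of x from P, which is the span
    separated' : ∀ i → 1 ≤ i → i < suc t → DistSetEq G (Span c' i) (c' i) 5
    separated' i i≥1 i<1+t with m<1+n⇒m<n∨m≡n i<1+t
    ... | inj₁ i<t =
          subst (λ z → DistSetEq G (Span c' i) z 5) (old i<t)
            (exact-map 5 (span-cong (λ k<i → old (<-trans k<i i<t)))
                         (span-cong (λ k<i → sym (old (<-trans k<i i<t))))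
                         (separated i i≥1 i<t))
    ... | inj₂ refl =
          subst (λ z → DistSetEq G (Span c' t) z 5) (sym (extend-≡ c t x))
            (exact-map 5 (span-cong old ∘ P⊆span) (span⊆P ∘ span-cong (sym ∘ old)) (descent-exact d))

    skeleton' : Skeleton (suc t) c' P'
    skeleton' = record
      { t≥1       = s≤s z≤n
      ; unique    = unique'
      ; size      = size'
      ; via-root  = subst (ConnectedVia P') (sym root) via-root'
      ; P⊆span    = P'⊆span
      ; centres∈P = centres∈P'
      ; separated = separated'
      }

  grow : ∀ {t c P} → Skeleton t c P → ∀ v → ¬ DistSetLe G (_∈ P) v 4 →
         ∃₂ λ c' P' → Skeleton (suc t) c' P'
  grow {c = c} sk v far =
    let (vs , v⇝root) = connected v (c 0)
        (_ , exact) = exact-distance (length vs) 4 (c 0 , centres∈P 0 t≥1 , vs , v⇝root , n≤1+n _) far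
        (_ , _ , d) = descent 5 exact
    in _ , _ , Extension.skeleton' sk d
    where open Skeleton sk

  Saturated : Set
  Saturated = ∃ λ t → ∃₂ λ c P → Skeleton t c P × (∀ v → DistSetLe G (_∈ P) v 4)

  -- Extend while possible; t ≤ |P| ≤ n bounds the number of extensions.
  saturate : ∀ fuel {t c P} → Skeleton t c P → n < t + fuel → Saturated
  saturate zero {t} sk n<t+0 =
    ⊥-elim (<⇒≱ n<t+0 (≤-trans (≤-reflexive (+-identityʳ t)) (≤-trans t≤|P| (unique-length-≤ unique))))
    where open Skeleton sk
  saturate (suc fuel) {t} {c} {P} sk n<t+1+fuel with any? (λ v → ¬? (near? P v 4))
  ... | yes (v , far) =
        let (_ , _ , sk') = grow sk v far in saturate fuel sk' (subst (n <_) (+-suc t fuel) n<t+1+fuel)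
  ... | no none = t , c , P , sk , λ v → decidable-stable (near? P v 4) (λ far → none (v , far))

  saturated : 1 ≤ n → Saturated
  saturated n≥1 = saturate n (initial (fromℕ< n≥1)) (n<1+n n)

  module _ {t c P} (sk : Skeleton t c P) where
    open Skeleton sk

    upper-bound : 5 * t ≤ n + 4
    upper-bound = subst (_≤ n + 4) size (+-monoˡ-≤ 4 (unique-length-≤ unique))

    neighbour-in : ∀ {q} → Adj G (c 0) q →
                   ∀ {y} → y ∈ q ∷ P → ∃ λ q' → q' ∈ q ∷ P × Adj G y q'
    neighbour-in root~q (here refl) = c 0 , there (centres∈P 0 t≥1) , Adj-sym root~q
    neighbour-in {q} root~q {y} (there y∈P) with y Fin.≟ c 0
    ... | yes refl = q , here refl , root~q
    ... | no y≢root =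
          let (_ , y⇝root , inside) = via-root y∈P in first-step y⇝root (All.map there inside) y≢root

    -- The lower bound on s: count 4-edge walks from the members of q ∷ P, q a neighbour of
    -- the root (if the root has none, n = 1).
    lower-bound : ∀ {Δ} → 1 ≤ Δ → MaxDegreeAtMost G Δ → (∀ v → DistSetLe G (_∈ P) v 4) →
                  n ≤ 5 * Δ ^ 4 * t
    lower-bound {Δ} Δ≥1 maxdeg covered with isolated-or-neighbour connected (c 0)
    ... | inj₁ n≤1 = ≤-trans n≤1 (≤-trans (s≤s z≤n) (*-mono-≤ (*-monoʳ-≤ 5 (^-monoˡ-≤ 4 Δ≥1)) t≥1))
    ... | inj₂ (q , root~q) = begin
      n
        ≤⟨ cover-count maxdeg 4 (q ∷ P) (near-map there ∘ covered) (neighbour-in root~q) ⟩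
      length (q ∷ P) * Δ ^ 4  ≤⟨ *-monoˡ-≤ (Δ ^ 4) |P|<5t ⟩
      5 * t * Δ ^ 4           ≡⟨ *-assoc 5 t (Δ ^ 4) ⟩
      5 * (t * Δ ^ 4)         ≡⟨ cong (5 *_) (*-comm t (Δ ^ 4)) ⟩
      5 * (Δ ^ 4 * t)         ≡⟨ sym (*-assoc 5 (Δ ^ 4) t) ⟩
      5 * Δ ^ 4 * t           ∎
      where open ≤-Reasoning

    span→InSpan : ∀ {i v} {Pr : Fin t → Set} → i ≤ t → (∀ j → toℕ j < i → Pr j) →
                  Span c i v → InSpan G Pr (c ∘ toℕ) v
    span→InSpan i≤t pr (a , b , a<i , b<i , vs , (w , uniq) , v∈) =
      fromℕ< a<t , fromℕ< b<t , pr _ (subst (_< _) (sym (toℕ-fromℕ< a<t)) a<i) ,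
      pr _ (subst (_< _) (sym (toℕ-fromℕ< b<t)) b<i) , vs ,
      (subst₂ (λ p q → Walk G p q vs) (cong c (sym (toℕ-fromℕ< a<t))) (cong c (sym (toℕ-fromℕ< b<t))) w ,
       uniq) , v∈
      where
      a<t = ≤-trans a<i i≤t
      b<t = ≤-trans b<i i≤t

    separated-Fin : ∀ (i : Fin t) → 1 ≤ toℕ i →
                    DistSetEq G (InSpan G (λ j → toℕ j < toℕ i) (c ∘ toℕ)) (c (toℕ i)) 5
    separated-Fin i i≥1 =
      exact-map 5 (span→InSpan (<⇒≤ (toℕ<n i)) (λ _ j<i → j<i))
                  (λ (a , b , a<i , b<i , path) → toℕ a , toℕ b , a<i , b<i , path)
                  (separated (toℕ i) i≥1 (toℕ<n i))

    covered-Fin : (∀ v → DistSetLe G (_∈ P) v 4) →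
                  ∀ v → DistSetLe G (InSpan G (λ _ → ⊤) (c ∘ toℕ)) v 4
    covered-Fin covered v = near-map (λ y∈P → span→InSpan ≤-refl (λ _ _ → tt) (P⊆span y∈P)) (covered v)

lemma3p2 : (Δ : ℕ) → 1 ≤ Δ → (n : ℕ) → (T : Graph n) → IsTree T → MaxDegreeAtMost T Δ →
    ∃ λ (s : ℕ) → Σ (Fin s → Fin n) λ x →
      (∀ (i : Fin s) → 1 ≤ toℕ i →
          DistSetEq T (InSpan T (λ j → toℕ j < toℕ i) x) (x i) 5)
      × (n ≤ 5 * Δ ^ 4 * s × 5 * s ≤ n + 4)
      × (∀ (v : Fin n) → DistSetLe T (InSpan T (λ _ → ⊤) x) v 4)
lemma3p2 Δ Δ≥1 n T (n≥1 , connected , acyclic) maxdeg =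
  let (s , c , P , sk , covered) = saturated n≥1
  in s , c ∘ toℕ , separated-Fin sk ,
     (lower-bound sk Δ≥1 maxdeg covered , upper-bound sk) , covered-Fin sk covered
  where open Greedy T connected acyclic
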